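{- Let $\lambda=(\lambda_1,\lambda_2)$ be a composition of $n$ with two positive parts. For all $0\le k\le\lambda_2$, $$N(v_k^{ -1})=\{t_1-t_b: b\in\{\lambda_1+1,\dots,\lambda_1+k\}\}\sqcup\{t_a-t_b: a\in\{2,\dots,\lambda_1\},\ b\in\{\lambda_1+1,\dots,n\}\}.$$
   Context: $S_n$ acts on linear forms in $t_1,\dots,t_n$ by $w(t_i)=t_{w(i)}$. $\Phi^+=\{t_i-t_j:i<j\}$, $\Phi^-=\{t_i-t_j:i>j\}$, and $N(w)=\{\gamma\in\Phi^+: w(\gamma)\in\Phi^-\}$, i.e. $t_a-t_b\in N(w)$ iff $a<b$ and $w(a)>w(b)$. For $0\le k\le\lambda_2$, $v_k$ is the permutation with one-line notation $[\lambda_1+1,\dots,\lambda_1+k,1,\lambda_1+k+1,\dots,n,2,3,\dots,\lambda_1]$. -}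

module Defs where

open import Data.Nat using (ℕ; suc; _+_; _∸_; _≤_; _<_; _≤ᵇ_)
open import Data.Bool using (if_then_else_)
open import Data.Fin using (Fin; toℕ)
open import Data.Fin.Permutation using (Permutation′; _⟨$⟩ʳ_)
open import Data.Product using (_×_)
open import Data.Sum using (_⊎_)
open import Relation.Binary.PropositionalEquality using (_≡_)

-- Indices: Fin n element i stands for the 1-based index (suc (toℕ i)).
pos : ∀ {n} → Fin n → ℕ
pos i = suc (toℕ i)

-- One-line notation of v_k for λ = (l₁ , l₂), n = l₁ + l₂, at 1-based position p:
-- [l₁+1, …, l₁+k, 1, l₁+k+1, …, n, 2, 3, …, l₁]
vOneLine : (l₁ l₂ k p : ℕ) → ℕ
vOneLine l₁ l₂ k p =
  if p ≤ᵇ k then l₁ + p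
  else if p ≤ᵇ suc k then 1
  else if p ≤ᵇ suc l₂ then l₁ + p ∸ 1
  else p ∸ l₂

-- Inversion set: t_a - t_b ∈ N(w)  iff  a < b and w(a) > w(b).
-- The pair (a , b) represents the root t_a - t_b.
InN : ∀ {n} → Permutation′ n → Fin n → Fin n → Set
InN w a b = pos a < pos b × pos (w ⟨$⟩ʳ b) < pos (w ⟨$⟩ʳ a)

RHS : (l₁ l₂ k a b : ℕ) → Set
RHS l₁ l₂ k a b =
  (a ≡ 1 × suc l₁ ≤ b × b ≤ l₁ + k)
  ⊎ (2 ≤ a × a ≤ l₁ × suc l₁ ≤ b × b ≤ l₁ + l₂)

-- The inverse of v_k has one-line notation [k+1, l₂+2, …, n, 1, …, k, k+2, …, l₂+1]:
-- it is increasing on each of the position blocks first = {1}, left = {2..l₁},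
-- moved = {l₁+1..l₁+k}, rest = {l₁+k+1..n}, which it sends to the value blocks
-- {k+1}, {l₂+2..n}, {1..k}, {k+2..l₂+1}. So an inversion of v_k⁻¹ is a pair of
-- positions in two blocks ordered one way by position and the other way by value,
-- namely (first, moved), (left, moved) or (left, rest): the right-hand side.
module Submission where

open import Defs
open import Data.Nat using (ℕ; zero; suc; _+_; _∸_; _≤_; _<_; _≤ᵇ_; z≤n; s≤s; _≤?_)
open import Data.Nat.Properties
open import Data.Bool using (true; false; if_then_else_)
open import Data.Fin using (Fin; fromℕ<)
open import Data.Fin.Properties using (toℕ<n; toℕ-fromℕ<; toℕ-injective)
open import Data.Fin.Permutation using (Permutation′; _⟨$⟩ʳ_; _⟨$⟩ˡ_; flip; inverseˡ)
open import Data.Product using (_×_; _,_)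
open import Data.Sum using (inj₁; inj₂)
open import Data.Empty using (⊥-elim)
open import Data.Unit using (tt)
open import Function using (_∘′_)
open import Function.Bundles using (_⇔_; mk⇔)
open import Relation.Nullary using (yes; no)
open import Relation.Binary.PropositionalEquality using (_≡_; refl; sym; trans; cong; subst; subst₂; module ≡-Reasoning)

if-≤ᵇ-yes : ∀ {A : Set} {m n} {x y : A} → m ≤ n → (if m ≤ᵇ n then x else y) ≡ x
if-≤ᵇ-yes {m = m} {n} m≤n with m ≤ᵇ n | ≤⇒≤ᵇ m≤n
... | true | _ = refl

if-≤ᵇ-no : ∀ {A : Set} {m n} {x y : A} → n < m → (if m ≤ᵇ n then x else y) ≡ y
if-≤ᵇ-no {m = m} {n} n<m with m ≤ᵇ n | ≤ᵇ⇒≤ m n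
... | false | _   = refl
... | true  | m≤n = ⊥-elim (<⇒≱ n<m (m≤n tt))

pos-injective : ∀ {n} {i j : Fin n} → pos i ≡ pos j → i ≡ j
pos-injective = toℕ-injective ∘′ suc-injective

pos-⟨$⟩ˡ : ∀ {n} (v : Permutation′ n) {f : ℕ → ℕ} →
  (∀ i → pos (v ⟨$⟩ʳ i) ≡ f (pos i)) →
  ∀ {x m} → 1 ≤ m → m ≤ n → f m ≡ pos x → pos (v ⟨$⟩ˡ x) ≡ m
pos-⟨$⟩ˡ v {f} oneLine {x} {suc m} _ m<n fm≡x = begin
  pos (v ⟨$⟩ˡ x)           ≡⟨ cong (λ y → pos (v ⟨$⟩ˡ y)) (sym vi≡x) ⟩
  pos (v ⟨$⟩ˡ (v ⟨$⟩ʳ i))  ≡⟨ cong pos (inverseˡ v) ⟩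
  pos i                    ≡⟨ pos-i ⟩
  suc m                    ∎
  where
  open ≡-Reasoning
  i = fromℕ< m<n
  pos-i : pos i ≡ suc m
  pos-i = cong suc (toℕ-fromℕ< m<n)
  vi≡x : v ⟨$⟩ʳ i ≡ x
  vi≡x = pos-injective (trans (oneLine i) (trans (cong f pos-i) fm≡x))

module Blocks (l₁ l₂ k : ℕ) (1≤l₁ : 1 ≤ l₁) (k≤l₂ : k ≤ l₂) where

  data Block : ℕ → Set where
    first : Block 1
    left  : ∀ {a} → 2 ≤ a → a ≤ l₁ → Block a
    moved : ∀ {c} → 1 ≤ c → c ≤ k → Block (l₁ + c)
    rest  : ∀ {d} → k < d → d ≤ l₂ → Block (l₁ + d)

  block : ∀ {a} → 1 ≤ a → a ≤ l₁ + l₂ → Block a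
  block {suc zero}    _ _   = first
  block {suc (suc a)} _ a≤n with suc (suc a) ≤? l₁
  ... | yes a≤l₁ = left (s≤s (s≤s z≤n)) a≤l₁
  ... | no  a≰l₁ =
    subst Block (m+[n∸m]≡n (<⇒≤ l₁<a)) (above (m<n⇒0<n∸m l₁<a) (m≤n+o⇒m∸n≤o _ l₁ a≤n))
    where
    l₁<a = ≰⇒> a≰l₁
    above : ∀ {d} → 1 ≤ d → d ≤ l₂ → Block (l₁ + d)
    above {d} 1≤d d≤l₂ with d ≤? k
    ... | yes d≤k = moved 1≤d d≤k
    ... | no  d≰k = rest (≰⇒> d≰k) d≤l₂

  v⁻¹ : ∀ {a} → Block a → ℕ
  v⁻¹ first           = suc k
  v⁻¹ (left {a} _ _)  = a + l₂
  v⁻¹ (moved {c} _ _) = c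
  v⁻¹ (rest {d} _ _)  = suc d

  Block⇒1≤ : ∀ {a} → Block a → 1 ≤ a
  Block⇒1≤ first         = ≤-refl
  Block⇒1≤ (left 2≤a _)  = ≤-trans (s≤s z≤n) 2≤a
  Block⇒1≤ (moved 1≤c _) = ≤-trans 1≤c (m≤n+m _ l₁)
  Block⇒1≤ (rest k<d _)  = ≤-trans (≤-trans (s≤s z≤n) k<d) (m≤n+m _ l₁)

  1≤v⁻¹ : ∀ {a} (A : Block a) → 1 ≤ v⁻¹ A
  1≤v⁻¹ first            = s≤s z≤n
  1≤v⁻¹ (left {a} 2≤a _) = ≤-trans (≤-trans (s≤s z≤n) 2≤a) (m≤m+n a l₂)
  1≤v⁻¹ (moved 1≤c _)    = 1≤c
  1≤v⁻¹ (rest _ _)       = s≤s z≤n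

  v⁻¹≤n : ∀ {a} (A : Block a) → v⁻¹ A ≤ l₁ + l₂
  v⁻¹≤n first         = +-mono-≤ 1≤l₁ k≤l₂
  v⁻¹≤n (left _ a≤l₁) = +-monoˡ-≤ l₂ a≤l₁
  v⁻¹≤n (moved _ c≤k) = ≤-trans (≤-trans c≤k k≤l₂) (m≤n+m l₂ l₁)
  v⁻¹≤n (rest _ d≤l₂) = +-mono-≤ 1≤l₁ d≤l₂

  vOneLine∘v⁻¹ : ∀ {a} (A : Block a) → vOneLine l₁ l₂ k (v⁻¹ A) ≡ a
  vOneLine∘v⁻¹ first = trans (if-≤ᵇ-no (n<1+n k)) (if-≤ᵇ-yes {m = suc k} ≤-refl)
  vOneLine∘v⁻¹ (left {a} 2≤a _) = begin
    vOneLine l₁ l₂ k (a + l₂)  ≡⟨ if-≤ᵇ-no (≤-trans (s≤s (m≤n⇒m≤1+n k≤l₂)) l₂+2≤a+l₂) ⟩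
    _                          ≡⟨ if-≤ᵇ-no (≤-trans (s≤s (s≤s k≤l₂)) l₂+2≤a+l₂) ⟩
    _                          ≡⟨ if-≤ᵇ-no l₂+2≤a+l₂ ⟩
    a + l₂ ∸ l₂                ≡⟨ m+n∸n≡m a l₂ ⟩
    a                          ∎
    where
    open ≡-Reasoning
    l₂+2≤a+l₂ : 2 + l₂ ≤ a + l₂
    l₂+2≤a+l₂ = +-monoˡ-≤ l₂ 2≤a
  vOneLine∘v⁻¹ (moved _ c≤k) = if-≤ᵇ-yes c≤k
  vOneLine∘v⁻¹ (rest {d} k<d d≤l₂) = begin
    vOneLine l₁ l₂ k (suc d)  ≡⟨ if-≤ᵇ-no {m = suc d} (m<n⇒m<1+n k<d) ⟩
    _                         ≡⟨ if-≤ᵇ-no {m = suc d} (s≤s k<d) ⟩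
    _                         ≡⟨ if-≤ᵇ-yes {m = suc d} (s≤s d≤l₂) ⟩
    l₁ + suc d ∸ 1            ≡⟨ cong (_∸ 1) (+-suc l₁ d) ⟩
    l₁ + d                    ∎
    where open ≡-Reasoning

  RHS⇒< : ∀ {a b} → RHS l₁ l₂ k a b → a < b
  RHS⇒< (inj₁ (refl , l₁<b , _))     = ≤-<-trans 1≤l₁ l₁<b
  RHS⇒< (inj₂ (_ , a≤l₁ , l₁<b , _)) = ≤-<-trans a≤l₁ l₁<b

  RHS⇒a≤l₁ : ∀ {a b} → RHS l₁ l₂ k a b → a ≤ l₁
  RHS⇒a≤l₁ (inj₁ (refl , _))     = 1≤l₁
  RHS⇒a≤l₁ (inj₂ (_ , a≤l₁ , _)) = a≤l₁

  RHS⇒l₁<b : ∀ {a b} → RHS l₁ l₂ k a b → l₁ < b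
  RHS⇒l₁<b (inj₁ (_ , l₁<b , _))     = l₁<b
  RHS⇒l₁<b (inj₂ (_ , _ , l₁<b , _)) = l₁<b

  RHS⇒v⁻¹> : ∀ {a b} (A : Block a) (B : Block b) → RHS l₁ l₂ k a b → v⁻¹ B < v⁻¹ A
  RHS⇒v⁻¹> _ first r             = ⊥-elim (<⇒≱ (RHS⇒l₁<b r) 1≤l₁)
  RHS⇒v⁻¹> _ (left _ b≤l₁) r     = ⊥-elim (<⇒≱ (RHS⇒l₁<b r) b≤l₁)
  RHS⇒v⁻¹> (moved 1≤c _) _ r     = ⊥-elim (<⇒≱ (m<m+n l₁ 1≤c) (RHS⇒a≤l₁ r))
  RHS⇒v⁻¹> (rest k<d _) _ r      = ⊥-elim (<⇒≱ (m<m+n l₁ (≤-<-trans z≤n k<d)) (RHS⇒a≤l₁ r))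
  RHS⇒v⁻¹> first (moved _ c≤k) _ = s≤s c≤k
  RHS⇒v⁻¹> first (rest k<d _) (inj₁ (_ , _ , l₁+d≤l₁+k)) =
    ⊥-elim (<⇒≱ k<d (+-cancelˡ-≤ l₁ _ _ l₁+d≤l₁+k))
  RHS⇒v⁻¹> first (rest _ _) (inj₂ (s≤s () , _))
  RHS⇒v⁻¹> (left 2≤a _) (moved _ c≤k) _ = +-mono-≤ (≤-trans (s≤s z≤n) 2≤a) (≤-trans c≤k k≤l₂)
  RHS⇒v⁻¹> (left 2≤a _) (rest _ d≤l₂) _ = +-mono-≤ 2≤a d≤l₂

  inversion⇒RHS : ∀ {a b} (A : Block a) (B : Block b) →
    a < b → v⁻¹ B < v⁻¹ A → RHS l₁ l₂ k a b
  inversion⇒RHS A first a<1 _ = ⊥-elim (<⇒≱ a<1 (Block⇒1≤ A))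
  inversion⇒RHS first (moved 1≤c c≤k) _ _ =
    inj₁ (refl , m<m+n l₁ 1≤c , +-monoʳ-≤ l₁ c≤k)
  inversion⇒RHS (left 2≤a a≤l₁) (moved 1≤c c≤k) _ _ =
    inj₂ (2≤a , a≤l₁ , m<m+n l₁ 1≤c , +-monoʳ-≤ l₁ (≤-trans c≤k k≤l₂))
  inversion⇒RHS (left 2≤a a≤l₁) (rest k<d d≤l₂) _ _ =
    inj₂ (2≤a , a≤l₁ , m<m+n l₁ (≤-<-trans z≤n k<d) , +-monoʳ-≤ l₁ d≤l₂)
  inversion⇒RHS first (left 2≤b _) _ b+l₂<1+k =
    ⊥-elim (<⇒≱ b+l₂<1+k (+-mono-≤ (≤-trans (s≤s z≤n) 2≤b) k≤l₂))
  inversion⇒RHS first (rest k<d _) _ (s≤s d<k) = ⊥-elim (<-asym k<d d<k)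
  inversion⇒RHS (left _ _) (left _ _) a<b b+l₂<a+l₂ =
    ⊥-elim (<-asym a<b (+-cancelʳ-< l₂ _ _ b+l₂<a+l₂))
  inversion⇒RHS (moved {c} _ _) (left _ b≤l₁) l₁+c<b _ =
    ⊥-elim (<⇒≱ l₁+c<b (≤-trans b≤l₁ (m≤m+n l₁ c)))
  inversion⇒RHS (rest {d} _ _) (left _ b≤l₁) l₁+d<b _ =
    ⊥-elim (<⇒≱ l₁+d<b (≤-trans b≤l₁ (m≤m+n l₁ d)))
  inversion⇒RHS (moved _ _) (moved _ _) l₁+c<l₁+c′ c′<c =
    ⊥-elim (<-asym (+-cancelˡ-< l₁ _ _ l₁+c<l₁+c′) c′<c)
  inversion⇒RHS (moved _ c≤k) (rest k<d _) _ 1+d<c =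
    ⊥-elim (<⇒≱ (<-trans (m<n⇒m<1+n k<d) 1+d<c) c≤k)
  inversion⇒RHS (rest k<d _) (moved _ c≤k) l₁+d<l₁+c _ =
    ⊥-elim (<⇒≱ (<-trans k<d (+-cancelˡ-< l₁ _ _ l₁+d<l₁+c)) c≤k)
  inversion⇒RHS (rest _ _) (rest _ _) l₁+d<l₁+d′ (s≤s d′<d) =
    ⊥-elim (<-asym (+-cancelˡ-< l₁ _ _ l₁+d<l₁+d′) d′<d)

  inversion⇔RHS : ∀ {a b} (A : Block a) (B : Block b) →
    (a < b × v⁻¹ B < v⁻¹ A) ⇔ RHS l₁ l₂ k a b
  inversion⇔RHS A B =
    mk⇔ (λ (a<b , B<A) → inversion⇒RHS A B a<b B<A) (λ r → RHS⇒< r , RHS⇒v⁻¹> A B r)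

lemma4p4 : (l₁ l₂ : ℕ) → 1 ≤ l₁ → 1 ≤ l₂ → (k : ℕ) → k ≤ l₂ →
    (v : Permutation′ (l₁ + l₂)) →
    (∀ i → pos (v ⟨$⟩ʳ i) ≡ vOneLine l₁ l₂ k (pos i)) →
    (a b : Fin (l₁ + l₂)) →
    InN (flip v) a b ⇔ RHS l₁ l₂ k (pos a) (pos b)
lemma4p4 l₁ l₂ 1≤l₁ _ k k≤l₂ v oneLine a b =
  subst₂ (λ i j → (pos a < pos b × j < i) ⇔ RHS l₁ l₂ k (pos a) (pos b))
    (sym (pos-flip a)) (sym (pos-flip b)) (inversion⇔RHS (blockOf a) (blockOf b))
  where
  open Blocks l₁ l₂ k 1≤l₁ k≤l₂
  blockOf : (x : Fin (l₁ + l₂)) → Block (pos x)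
  blockOf x = block (s≤s z≤n) (toℕ<n x)
  pos-flip : ∀ x → pos (flip v ⟨$⟩ʳ x) ≡ v⁻¹ (blockOf x)
  pos-flip x = pos-⟨$⟩ˡ v {vOneLine l₁ l₂ k} oneLine (1≤v⁻¹ B) (v⁻¹≤n B) (vOneLine∘v⁻¹ B)
    where B = blockOf x
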